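{- Let $V$ be the valuation ring of a valuation $v$ on a field $K$, $S\subseteq V$, $f\in\operatorname{Int}(S,V)$, and let $[f]$ be the divisor-closed submonoid of $\operatorname{Int}(S,V)$ generated by $f$. Let $g\in[f]$ and $a\in K$. If $-\min_{s\in S}v(g(s))\le v(a)\le 0$, then $ag\in[f]$.
   Context: $\operatorname{Int}(S,V)=\{h\in K[x]\mid h(S)\subseteq V\}$. $[f]$ is the multiplicative monoid of all $g\in\operatorname{Int}(S,V)$ for which there exist $m\in\mathbb N$ and $h\in\operatorname{Int}(S,V)$ with $gh=f^m$. Valuations are written additively with $v(0)=\infty$. -}

module Defs where

open import Level using (Level; _⊔_; suc)
open import Algebra.Bundles using (CommutativeRing; AbelianGroup)
open import Relation.Binary.Structures using (IsTotalOrder)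
open import Relation.Nullary using (¬_)
open import Relation.Unary using (Pred)
open import Data.Product using (Σ; ∃; _×_; _,_)
open import Data.Sum using (_⊎_)
open import Data.Unit.Polymorphic using (⊤)
open import Data.Empty.Polymorphic using (⊥)
open import Data.List using (List; []; _∷_; map)
open import Data.Nat using (ℕ; zero) renaming (suc to 1+)

record Field (c ℓ : Level) : Set (suc (c ⊔ ℓ)) where
  field
    commutativeRing : CommutativeRing c ℓ
  open CommutativeRing commutativeRing public
  field
    1≉0     : ¬ (1# ≈ 0#)
    inverse : ∀ x → ¬ (x ≈ 0#) → Σ Carrier λ y → (x * y) ≈ 1#

record OrderedAbelianGroup (c ℓ₁ ℓ₂ : Level) : Set (suc (c ⊔ ℓ₁ ⊔ ℓ₂)) where
  field
    abelianGroup : AbelianGroup c ℓ₁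
  open AbelianGroup abelianGroup public
  field
    _≤_          : Carrier → Carrier → Set ℓ₂
    isTotalOrder : IsTotalOrder _≈_ _≤_
    ≤-compat     : ∀ {x y} z → x ≤ y → (x ∙ z) ≤ (y ∙ z)

module Extended {c ℓ₁ ℓ₂} (Γ : OrderedAbelianGroup c ℓ₁ ℓ₂) where
  open OrderedAbelianGroup Γ

  data Γ∞ : Set c where
    fin : Carrier → Γ∞
    ∞   : Γ∞

  _≈∞_ : Γ∞ → Γ∞ → Set ℓ₁
  fin a ≈∞ fin b = a ≈ b
  fin a ≈∞ ∞     = ⊥
  ∞     ≈∞ fin b = ⊥
  ∞     ≈∞ ∞     = ⊤

  _≤∞_ : Γ∞ → Γ∞ → Set ℓ₂
  fin a ≤∞ fin b = a ≤ b
  fin a ≤∞ ∞     = ⊤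
  ∞     ≤∞ fin b = ⊥
  ∞     ≤∞ ∞     = ⊤

  _+∞_ : Γ∞ → Γ∞ → Γ∞
  fin a +∞ fin b = fin (a ∙ b)
  fin a +∞ ∞     = ∞
  ∞     +∞ _     = ∞

  0∞ : Γ∞
  0∞ = fin ε

  -- "- m ≤ w"  (with - ∞ = -∞, which is below everything)
  neg≤ : Γ∞ → Γ∞ → Set ℓ₂
  neg≤ (fin a) w = fin (a ⁻¹) ≤∞ w
  neg≤ ∞       w = ⊤

record Valuation {c ℓ c' ℓ₁ ℓ₂} (K : Field c ℓ) (Γ : OrderedAbelianGroup c' ℓ₁ ℓ₂)
       : Set (c ⊔ ℓ ⊔ c' ⊔ ℓ₁ ⊔ ℓ₂) where
  open Field K
  open Extended Γ
  field
    v       : Carrier → Γ∞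
    v-cong  : ∀ {x y} → x ≈ y → v x ≈∞ v y
    v-∞⇒0   : ∀ x → v x ≈∞ ∞ → x ≈ 0#
    v-0     : v 0# ≈∞ ∞
    v-mul   : ∀ x y → v (x * y) ≈∞ (v x +∞ v y)
    v-add   : ∀ x y → (v x ≤∞ v (x + y)) ⊎ (v y ≤∞ v (x + y))

-- Polynomials K[x] as coefficient lists (constant term first).
module Polynomials {c ℓ} (K : Field c ℓ) where
  open Field K

  Poly : Set c
  Poly = List Carrier

  _≈ₚ_ : Poly → Poly → Set ℓ
  []      ≈ₚ []      = ⊤
  (a ∷ p) ≈ₚ []      = (a ≈ 0#) × (p ≈ₚ [])
  []      ≈ₚ (b ∷ q) = (0# ≈ b) × ([] ≈ₚ q)
  (a ∷ p) ≈ₚ (b ∷ q) = (a ≈ b) × (p ≈ₚ q)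

  _+ₚ_ : Poly → Poly → Poly
  []      +ₚ q       = q
  (a ∷ p) +ₚ []      = a ∷ p
  (a ∷ p) +ₚ (b ∷ q) = (a + b) ∷ (p +ₚ q)

  _·ₚ_ : Carrier → Poly → Poly
  a ·ₚ p = map (a *_) p

  _*ₚ_ : Poly → Poly → Poly
  []      *ₚ q = []
  (a ∷ p) *ₚ q = (a ·ₚ q) +ₚ (0# ∷ (p *ₚ q))

  _^ₚ_ : Poly → ℕ → Poly
  p ^ₚ zero   = 1# ∷ []
  p ^ₚ (1+ m) = p *ₚ (p ^ₚ m)

  eval : Poly → Carrier → Carrier
  eval []      x = 0#
  eval (a ∷ p) x = a + (x * eval p x)

module IntValued {c ℓ c' ℓ₁ ℓ₂ ℓs} (K : Field c ℓ) (Γ : OrderedAbelianGroup c' ℓ₁ ℓ₂)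
                 (val : Valuation K Γ) (S : Pred (Field.Carrier K) ℓs) where
  open Field K
  open Extended Γ
  open Valuation val
  open Polynomials K

  InV : Carrier → Set ℓ₂
  InV x = 0∞ ≤∞ v x

  InInt : Poly → Set (c ⊔ ℓs ⊔ ℓ₂)
  InInt h = ∀ s → S s → InV (eval h s)

  In[_] : Poly → Poly → Set (c ⊔ ℓ ⊔ ℓs ⊔ ℓ₂)
  In[ f ] g = InInt g × ∃ λ (m : ℕ) → ∃ λ (h : Poly) → InInt h × ((g *ₚ h) ≈ₚ (f ^ₚ m))

{-# OPTIONS --safe #-}
module Submission where

-- If g h = fᵐ with h ∈ Int(S,V), then also (a g)(a⁻¹ h) = fᵐ, so it suffices that both
-- factors lie in Int(S,V).  For a g, minimality of s₀ gives
-- v(a) + v(g(s)) ≥ v(a) + v(g(s₀)) ≥ 0; for a⁻¹ h, v(a) ≤ 0 gives v(a⁻¹) ≥ 0.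

open import Defs
open import Level using (Level; _⊔_)
open import Relation.Unary using (Pred)
open import Relation.Nullary using (¬_)
open import Relation.Binary.Bundles using (TotalOrder)
open import Data.Product using (Σ; _×_; _,_; proj₁; proj₂)
open import Data.Unit.Polymorphic using (tt)
open import Data.Empty using (⊥-elim)
open import Data.List using ([]; _∷_)
open import Data.List.Relation.Binary.Pointwise using (Pointwise; []; _∷_)
import Algebra.Properties.Group as GroupProperties
import Algebra.Properties.CommutativeSemigroup as CommutativeSemigroupProperties
import Relation.Binary.Reasoning.PartialOrder as ≤-Reasoning

module OrderedAbelianGroupProperties {c ℓ₁ ℓ₂} (Γ : OrderedAbelianGroup c ℓ₁ ℓ₂) where
  open OrderedAbelianGroup Γ
  open GroupProperties group using (identityˡ-unique)

  totalOrder : TotalOrder c ℓ₁ ℓ₂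
  totalOrder = record { isTotalOrder = isTotalOrder }

  open TotalOrder totalOrder using (poset)
  open ≤-Reasoning poset

  ≤-compatˡ : ∀ {x y} z → x ≤ y → (z ∙ x) ≤ (z ∙ y)
  ≤-compatˡ {x} {y} z x≤y = begin
    z ∙ x  ≈⟨ comm z x ⟩
    x ∙ z  ≤⟨ ≤-compat z x≤y ⟩
    y ∙ z  ≈⟨ comm y z ⟩
    z ∙ y  ∎

  ∙-mono-≤ : ∀ {x y u w} → x ≤ y → u ≤ w → (x ∙ u) ≤ (y ∙ w)
  ∙-mono-≤ {x} {y} {u} {w} x≤y u≤w = begin
    x ∙ u  ≤⟨ ≤-compat u x≤y ⟩
    y ∙ u  ≤⟨ ≤-compatˡ y u≤w ⟩
    y ∙ w  ∎

  ⁻¹≤∧≤⇒ε≤∙ : ∀ {α γ δ} → (γ ⁻¹) ≤ α → γ ≤ δ → ε ≤ (α ∙ δ)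
  ⁻¹≤∧≤⇒ε≤∙ {α} {γ} {δ} γ⁻¹≤α γ≤δ = begin
    ε        ≈⟨ sym (inverseˡ γ) ⟩
    γ ⁻¹ ∙ γ ≤⟨ ∙-mono-≤ γ⁻¹≤α γ≤δ ⟩
    α ∙ δ    ∎

  ε≤∧ε≤⇒ε≤∙ : ∀ {β η} → ε ≤ β → ε ≤ η → ε ≤ (β ∙ η)
  ε≤∧ε≤⇒ε≤∙ {β} {η} ε≤β ε≤η = begin
    ε      ≈⟨ sym (identityˡ ε) ⟩
    ε ∙ ε  ≤⟨ ∙-mono-≤ ε≤β ε≤η ⟩
    β ∙ η  ∎

  ≤ε∧∙≈ε⇒ε≤ : ∀ {α β} → α ≤ ε → (α ∙ β) ≈ ε → ε ≤ β
  ≤ε∧∙≈ε⇒ε≤ {α} {β} α≤ε αβ≈ε = begin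
    ε      ≈⟨ sym αβ≈ε ⟩
    α ∙ β  ≤⟨ ≤-compat β α≤ε ⟩
    ε ∙ β  ≈⟨ identityˡ β ⟩
    β      ∎

  idempotent⇒ε : ∀ {e} → (e ∙ e) ≈ e → e ≈ ε
  idempotent⇒ε {e} = identityˡ-unique e e

module ExtendedProperties {c ℓ₁ ℓ₂} (Γ : OrderedAbelianGroup c ℓ₁ ℓ₂) where
  open OrderedAbelianGroup Γ
  open OrderedAbelianGroupProperties Γ
  open Extended Γ

  ≈∞-sym : ∀ {x y} → x ≈∞ y → y ≈∞ x
  ≈∞-sym {fin a} {fin b} a≈b = sym a≈b
  ≈∞-sym {∞}     {∞}     _   = tt

  ≈∞-trans : ∀ {x y z} → x ≈∞ y → y ≈∞ z → x ≈∞ z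
  ≈∞-trans {fin a} {fin b} {fin d} a≈b b≈d = trans a≈b b≈d
  ≈∞-trans {∞}     {∞}     {∞}     _   _   = tt

  0≤∞-resp-≈∞ : ∀ {w w'} → w ≈∞ w' → 0∞ ≤∞ w' → 0∞ ≤∞ w
  0≤∞-resp-≈∞ {fin a} {fin b} a≈b ε≤b = TotalOrder.≤-respʳ-≈ totalOrder (sym a≈b) ε≤b
  0≤∞-resp-≈∞ {∞}     {∞}     _   _   = tt

  neg≤∧≤⇒0≤+∞ : ∀ A M W → neg≤ M A → M ≤∞ W → 0∞ ≤∞ (A +∞ W)
  neg≤∧≤⇒0≤+∞ (fin α) (fin γ) (fin δ) γ⁻¹≤α γ≤δ = ⁻¹≤∧≤⇒ε≤∙ γ⁻¹≤α γ≤δ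
  neg≤∧≤⇒0≤+∞ (fin α) M       ∞       _     _   = tt
  neg≤∧≤⇒0≤+∞ ∞       M       W       _     _   = tt

  0≤∧0≤⇒0≤+∞ : ∀ B W → 0∞ ≤∞ B → 0∞ ≤∞ W → 0∞ ≤∞ (B +∞ W)
  0≤∧0≤⇒0≤+∞ (fin β) (fin η) ε≤β ε≤η = ε≤∧ε≤⇒ε≤∙ ε≤β ε≤η
  0≤∧0≤⇒0≤+∞ (fin β) ∞       _   _   = tt
  0≤∧0≤⇒0≤+∞ ∞       W       _   _   = tt

  ≤0∧+∞≈0⇒0≤ : ∀ A B → A ≤∞ 0∞ → (A +∞ B) ≈∞ 0∞ → 0∞ ≤∞ B
  ≤0∧+∞≈0⇒0≤ (fin α) (fin β) α≤ε αβ≈ε = ≤ε∧∙≈ε⇒ε≤ α≤ε αβ≈ε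

module ValuationProperties {c ℓ c' ℓ₁ ℓ₂} {K : Field c ℓ} {Γ : OrderedAbelianGroup c' ℓ₁ ℓ₂}
                           (val : Valuation K Γ) where
  open Field K
  open Extended Γ
  open ExtendedProperties Γ
  open OrderedAbelianGroupProperties Γ using (idempotent⇒ε)
  open Valuation val

  v-1# : v 1# ≈∞ 0∞
  v-1# = finite-idempotent (v 1#) (v-∞⇒0 1#) v1≈v1+v1
    where
    v1≈v1+v1 : v 1# ≈∞ (v 1# +∞ v 1#)
    v1≈v1+v1 = ≈∞-trans {v 1#} {v (1# * 1#)} (v-cong (sym (*-identityˡ 1#))) (v-mul 1# 1#)

    finite-idempotent : ∀ w → (w ≈∞ ∞ → 1# ≈ 0#) → w ≈∞ (w +∞ w) → w ≈∞ 0∞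
    finite-idempotent (fin e) _    e≈e∙e = idempotent⇒ε (OrderedAbelianGroup.sym Γ e≈e∙e)
    finite-idempotent ∞       v1≈∞ _     = ⊥-elim (1≉0 (v1≈∞ tt))

  v≤0⇒≉0 : ∀ {a} → v a ≤∞ 0∞ → ¬ (a ≈ 0#)
  v≤0⇒≉0 {a} va≤0 a≈0 = ≤0∞⇒≉∞ (v a) va≤0 (≈∞-trans {v a} {v 0#} (v-cong a≈0) v-0)
    where
    ≤0∞⇒≉∞ : ∀ w → w ≤∞ 0∞ → ¬ (w ≈∞ ∞)
    ≤0∞⇒≉∞ (fin α) _ ()

  v≤0⇒v-inverse≥0 : ∀ {a b} → v a ≤∞ 0∞ → (a * b) ≈ 1# → 0∞ ≤∞ v b
  v≤0⇒v-inverse≥0 {a} {b} va≤0 ab≈1 = ≤0∧+∞≈0⇒0≤ (v a) (v b) va≤0 va+vb≈0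
    where
    va+vb≈0 : (v a +∞ v b) ≈∞ 0∞
    va+vb≈0 = ≈∞-trans {v a +∞ v b} {v (a * b)} (≈∞-sym {v (a * b)} (v-mul a b))
                       (≈∞-trans {v (a * b)} {v 1#} (v-cong ab≈1) v-1#)

module PolynomialProperties {c ℓ} (K : Field c ℓ) where
  open Field K
  open Polynomials K
  open CommutativeSemigroupProperties *-commutativeSemigroup using (interchange; x∙yz≈y∙xz)
  open import Relation.Binary.Reasoning.Setoid setoid

  _≋_ : Poly → Poly → Set (c ⊔ ℓ)
  _≋_ = Pointwise _≈_

  eval-·ₚ : ∀ a p x → eval (a ·ₚ p) x ≈ (a * eval p x)
  eval-·ₚ a []      x = sym (zeroʳ a)
  eval-·ₚ a (d ∷ p) x = begin
    a * d + x * eval (a ·ₚ p) x  ≈⟨ +-congˡ (*-congˡ (eval-·ₚ a p x)) ⟩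
    a * d + x * (a * eval p x)   ≈⟨ +-congˡ (x∙yz≈y∙xz x a (eval p x)) ⟩
    a * d + a * (x * eval p x)   ≈⟨ distribˡ a d (x * eval p x) ⟨
    a * (d + x * eval p x)       ∎

  ≋-≈ₚ-trans : ∀ {p q r} → p ≋ q → q ≈ₚ r → p ≈ₚ r
  ≋-≈ₚ-trans {r = []}    []            q≈r         = q≈r
  ≋-≈ₚ-trans {r = []}    (x≈y ∷ p≋q)   (y≈0 , q≈r) = trans x≈y y≈0 , ≋-≈ₚ-trans p≋q q≈r
  ≋-≈ₚ-trans {r = _ ∷ _} []            q≈r         = q≈r
  ≋-≈ₚ-trans {r = _ ∷ _} (x≈y ∷ p≋q)   (y≈z , q≈r) = trans x≈y y≈z , ≋-≈ₚ-trans p≋q q≈r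

  +ₚ-cong : ∀ {p p' q q'} → p ≋ p' → q ≋ q' → (p +ₚ q) ≋ (p' +ₚ q')
  +ₚ-cong []          q≋q'        = q≋q'
  +ₚ-cong (x≈y ∷ p≋p') []          = x≈y ∷ p≋p'
  +ₚ-cong (x≈y ∷ p≋p') (u≈w ∷ q≋q') = +-cong x≈y u≈w ∷ +ₚ-cong p≋p' q≋q'

  module _ {a b : Carrier} (ab≈1 : (a * b) ≈ 1#) where

    ·ₚ-·ₚ-inverse : ∀ d q → ((a * d) ·ₚ (b ·ₚ q)) ≋ (d ·ₚ q)
    ·ₚ-·ₚ-inverse d []      = []
    ·ₚ-·ₚ-inverse d (x ∷ q) = cancel x ∷ ·ₚ-·ₚ-inverse d q
      where
      cancel : ∀ x → ((a * d) * (b * x)) ≈ (d * x)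
      cancel x = begin
        (a * d) * (b * x)  ≈⟨ interchange a d b x ⟩
        (a * b) * (d * x)  ≈⟨ *-congʳ ab≈1 ⟩
        1# * (d * x)       ≈⟨ *-identityˡ (d * x) ⟩
        d * x              ∎

    *ₚ-·ₚ-inverse : ∀ p q → ((a ·ₚ p) *ₚ (b ·ₚ q)) ≋ (p *ₚ q)
    *ₚ-·ₚ-inverse []      q = []
    *ₚ-·ₚ-inverse (d ∷ p) q = +ₚ-cong (·ₚ-·ₚ-inverse d q) (refl ∷ *ₚ-·ₚ-inverse p q)

module IntValuedProperties {c ℓ c' ℓ₁ ℓ₂ ℓs} {K : Field c ℓ} {Γ : OrderedAbelianGroup c' ℓ₁ ℓ₂}
                           (val : Valuation K Γ) (S : Pred (Field.Carrier K) ℓs) where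
  open Field K
  open Extended Γ
  open ExtendedProperties Γ
  open Valuation val
  open Polynomials K
  open PolynomialProperties K using (eval-·ₚ)
  open IntValued K Γ val S

  ·ₚ-InInt : ∀ a p → (∀ s → S s → 0∞ ≤∞ (v a +∞ v (eval p s))) → InInt (a ·ₚ p)
  ·ₚ-InInt a p 0≤va+vp s s∈S =
    0≤∞-resp-≈∞ {v (eval (a ·ₚ p) s)} {v a +∞ v (eval p s)}
      (≈∞-trans {v (eval (a ·ₚ p) s)} {v (a * eval p s)} (v-cong (eval-·ₚ a p s)) (v-mul a (eval p s)))
      (0≤va+vp s s∈S)

lemma1p3 : ∀ {c ℓ c' ℓ₁ ℓ₂ ℓs : Level}
    (K : Field c ℓ) (Γ : OrderedAbelianGroup c' ℓ₁ ℓ₂) (val : Valuation K Γ)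
    (S : Pred (Field.Carrier K) ℓs) →
    let open Field K
        open Extended Γ
        open Valuation val
        open Polynomials K
        open IntValued K Γ val S
    in (∀ s → S s → InV s) →
       (f g : Poly) (a : Carrier) →
       InInt f →
       In[ f ] g →
       -- s₀ ∈ S realises min_{s ∈ S} v(g(s)), and - v(g(s₀)) ≤ v(a) ≤ 0
       (Σ Carrier λ s₀ → S s₀ × (∀ s → S s → v (eval g s₀) ≤∞ v (eval g s))
                          × neg≤ (v (eval g s₀)) (v a)) →
       v a ≤∞ 0∞ →
       In[ f ] (a ·ₚ g)
lemma1p3 K Γ val S _ f g a _ (_ , m , h , h∈Int , gh≈fᵐ) (s₀ , _ , s₀-minimal , -vgs₀≤va) va≤0 =
  ·ₚ-InInt a g (λ s s∈S →
    neg≤∧≤⇒0≤+∞ (v a) (v (eval g s₀)) (v (eval g s)) -vgs₀≤va (s₀-minimal s s∈S)) ,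
  m , b ·ₚ h ,
  ·ₚ-InInt b h (λ s s∈S →
    0≤∧0≤⇒0≤+∞ (v b) (v (eval h s)) (v≤0⇒v-inverse≥0 va≤0 ab≈1) (h∈Int s s∈S)) ,
  ≋-≈ₚ-trans (*ₚ-·ₚ-inverse ab≈1 g h) gh≈fᵐ
  where
  open Field K
  open Valuation val
  open ExtendedProperties Γ
  open ValuationProperties val
  open PolynomialProperties K
  open IntValuedProperties val S
  open Polynomials K

  b : Carrier
  b = proj₁ (inverse a (v≤0⇒≉0 va≤0))

  ab≈1 : (a * b) ≈ 1#
  ab≈1 = proj₂ (inverse a (v≤0⇒≉0 va≤0))
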